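{- Every $x*x$-balanced string over the binary alphabet $\{\mathsf{a},\mathsf{b}\}$ of positive length is the concatenation $t_1t_2$ of two $x*y$-balanced strings $t_1,t_2$ over $\{\mathsf{a},\mathsf{b}\}$ of positive length.
   Context: For a string $s$, $|s|$ is its length, $s(i)$ its $i$-th letter. A string over $\{\mathsf{a},\mathsf{b}\}$ is balanced if it contains as many $\mathsf{a}$'s as $\mathsf{b}$'s; it is $x*x$-balanced if it is balanced and $s(1)=s(|s|)$, and $x*y$-balanced if it is balanced and $s(1)\ne s(|s|)$ (the empty string counts as both). -}

module Defs where

open import Data.Nat using (ℕ; zero; suc)
open import Data.List using (List; []; _∷_; length)
open import Relation.Binary.PropositionalEquality using (_≡_; _≢_)
open import Data.Product using (_×_)
open import Data.Sum using (_⊎_)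

data AB : Set where
  a b : AB

Str : Set
Str = List AB

count : AB → Str → ℕ
count x [] = zero
count a (a ∷ s) = suc (count a s)
count a (b ∷ s) = count a s
count b (a ∷ s) = count b s
count b (b ∷ s) = suc (count b s)

Balanced : Str → Set
Balanced s = count a s ≡ count b s

data First : Str → AB → Set where
  first : ∀ x s → First (x ∷ s) x

data Last : Str → AB → Set where
  last-one  : ∀ x → Last (x ∷ []) x
  last-cons : ∀ {y s} x → Last s y → Last (x ∷ s) y

XXBalanced : Str → Set
XXBalanced s = Balanced s × (s ≡ [] ⊎ (∀ x y → First s x → Last s y → x ≡ y))

XYBalanced : Str → Set
XYBalanced s = Balanced s × (s ≡ [] ⊎ (∀ x y → First s x → Last s y → x ≢ y))

-- Walk through the inner part q of s = x q x, stepping up on the letter y ≠ x and down on x.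
-- Since s is balanced, the walk ends two levels up, so after its last visit to level 0 it
-- takes two up-steps in a row: q = p y y r with p balanced. Then s = (x p y)(y r x), and
-- both factors are balanced with distinct end letters.
module Submission where

open import Defs
open import Data.Nat using (zero; suc; _+_; _>_; s≤s; z≤n)
open import Data.Nat.Properties using (+-suc; +-comm; +-cancelˡ-≡; suc-injective)
open import Data.List using ([]; _∷_; [_]; length; _++_; _∷ʳ_; initLast; _∷ʳ′_)
open import Data.List.Properties using (++-assoc)
open import Data.Product using (∃₂; _×_; _,_)
open import Data.Sum using (_⊎_; inj₁; inj₂)
open import Relation.Nullary using (¬_)
open import Relation.Binary.PropositionalEquality
  using (_≡_; _≢_; refl; sym; trans; cong; subst; module ≡-Reasoning)

flip : AB → AB
flip a = b
flip b = a

x≢flip-x : ∀ x → x ≢ flip x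
x≢flip-x a ()
x≢flip-x b ()

flip-x≢x : ∀ x → flip x ≢ x
flip-x≢x a ()
flip-x≢x b ()

letter-view : ∀ x c → c ≡ x ⊎ c ≡ flip x
letter-view a a = inj₁ refl
letter-view a b = inj₂ refl
letter-view b a = inj₂ refl
letter-view b b = inj₁ refl

count-∷-≡ : ∀ x s → count x (x ∷ s) ≡ suc (count x s)
count-∷-≡ a s = refl
count-∷-≡ b s = refl

count-∷-≢ : ∀ {x y} s → x ≢ y → count x (y ∷ s) ≡ count x s
count-∷-≢ {a} {a} s x≢y with () ← x≢y refl
count-∷-≢ {a} {b} s x≢y = refl
count-∷-≢ {b} {a} s x≢y = refl
count-∷-≢ {b} {b} s x≢y with () ← x≢y refl

count-++ : ∀ z p q → count z (p ++ q) ≡ count z p + count z q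
count-++ z [] q = refl
count-++ a (a ∷ p) q = cong suc (count-++ a p q)
count-++ a (b ∷ p) q = count-++ a p q
count-++ b (a ∷ p) q = count-++ b p q
count-++ b (b ∷ p) q = cong suc (count-++ b p q)

count-∷ʳ : ∀ z w y → count z (w ∷ʳ y) ≡ count z (y ∷ w)
count-∷ʳ z w y = trans (count-++ z w [ y ]) (trans (+-comm (count z w) _) (sym (count-++ z [ y ] w)))

count-flip≡count⇒Balanced : ∀ x s → count (flip x) s ≡ count x s → Balanced s
count-flip≡count⇒Balanced a s e = sym e
count-flip≡count⇒Balanced b s e = e

Balanced-[_]-impossible : ∀ z → ¬ Balanced [ z ]
Balanced-[ a ]-impossible ()
Balanced-[ b ]-impossible ()

Balanced-++⁻ʳ : ∀ u v → Balanced (u ++ v) → Balanced u → Balanced v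
Balanced-++⁻ʳ u v uv bal-u = +-cancelˡ-≡ (count b u) _ _ (begin
  count b u + count a v  ≡⟨ cong (_+ count a v) (sym bal-u) ⟩
  count a u + count a v  ≡⟨ sym (count-++ a u v) ⟩
  count a (u ++ v)       ≡⟨ uv ⟩
  count b (u ++ v)       ≡⟨ count-++ b u v ⟩
  count b u + count b v  ∎)
  where open ≡-Reasoning

Balanced-wrap : ∀ x s → Balanced s → Balanced (x ∷ s ∷ʳ flip x)
Balanced-wrap a s e = trans (cong suc (trans (count-∷ʳ a s b) e)) (sym (count-∷ʳ b s b))
Balanced-wrap b s e = trans (count-∷ʳ a s a) (cong suc (trans e (sym (count-∷ʳ b s a))))

Balanced-xx⇒count-flip : ∀ x q → Balanced (x ∷ q ∷ʳ x) → count (flip x) q ≡ 2 + count x q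
Balanced-xx⇒count-flip a q e = trans (sym (count-∷ʳ b q a)) (trans (sym e) (cong suc (count-∷ʳ a q a)))
Balanced-xx⇒count-flip b q e = trans (sym (count-∷ʳ a q b)) (trans e (cong suc (count-∷ʳ b q b)))

Last-∷ʳ : ∀ w y → Last (w ∷ʳ y) y
Last-∷ʳ [] y = last-one y
Last-∷ʳ (c ∷ w) y = last-cons c (Last-∷ʳ w y)

Last-∷ʳ-unique : ∀ w {y z} → Last (w ∷ʳ y) z → z ≡ y
Last-∷ʳ-unique [] (last-one _) = refl
Last-∷ʳ-unique (c ∷ []) (last-cons _ L) = Last-∷ʳ-unique [] L
Last-∷ʳ-unique (c ∷ d ∷ w) (last-cons _ L) = Last-∷ʳ-unique (d ∷ w) L

XYBalanced-wrap : ∀ {x y} w → x ≢ y → Balanced (x ∷ w ∷ʳ y) → XYBalanced (x ∷ w ∷ʳ y)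
XYBalanced-wrap w x≢y bal =
  bal , inj₂ λ { _ _ (first _ _) L x≡z → x≢y (trans x≡z (Last-∷ʳ-unique (_ ∷ w) L)) }

yy-split : ∀ x h w → count (flip x) w ≡ 2 + h + count x w →
  ∃₂ λ p r → w ≡ p ++ flip x ∷ flip x ∷ r × count (flip x) p ≡ h + count x p
yy-split x h [] ()
yy-split x h (c ∷ w) e with letter-view x c
yy-split x h (.x ∷ w) e | inj₁ refl =
  let p , r , w≡ , excess = yy-split x (suc h) w up in
  x ∷ p , r , cong (x ∷_) w≡ , (begin
    count y (x ∷ p)      ≡⟨ count-∷-≢ p (flip-x≢x x) ⟩
    count y p            ≡⟨ excess ⟩
    suc h + count x p    ≡⟨ sym (+-suc h _) ⟩
    h + suc (count x p)  ≡⟨ cong (h +_) (sym (count-∷-≡ x p)) ⟩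
    h + count x (x ∷ p)  ∎)
  where
  open ≡-Reasoning
  y : AB
  y = flip x
  up : count y w ≡ 2 + suc h + count x w
  up = begin
    count y w                ≡⟨ sym (count-∷-≢ w (flip-x≢x x)) ⟩
    count y (x ∷ w)          ≡⟨ e ⟩
    2 + h + count x (x ∷ w)  ≡⟨ cong (2 + h +_) (count-∷-≡ x w) ⟩
    2 + h + suc (count x w)  ≡⟨ +-suc (2 + h) _ ⟩
    2 + suc h + count x w    ∎
yy-split x (suc h) (.(flip x) ∷ w) e | inj₂ refl =
  let p , r , w≡ , excess = yy-split x h w down in
  y ∷ p , r , cong (y ∷_) w≡ , (begin
    count y (y ∷ p)          ≡⟨ count-∷-≡ y p ⟩
    suc (count y p)          ≡⟨ cong suc excess ⟩
    suc h + count x p        ≡⟨ cong (suc h +_) (sym (count-∷-≢ p (x≢flip-x x))) ⟩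
    suc h + count x (y ∷ p)  ∎)
  where
  open ≡-Reasoning
  y : AB
  y = flip x
  down : count y w ≡ 2 + h + count x w
  down = suc-injective (begin
    suc (count y w)          ≡⟨ sym (count-∷-≡ y w) ⟩
    count y (y ∷ w)          ≡⟨ e ⟩
    3 + h + count x (y ∷ w)  ≡⟨ cong (3 + h +_) (count-∷-≢ w (x≢flip-x x)) ⟩
    3 + h + count x w        ∎)
yy-split x zero (.(flip x) ∷ w) e | inj₂ refl = from-level-one w level-one
  where
  open ≡-Reasoning
  y : AB
  y = flip x
  level-one : count y w ≡ 1 + count x w
  level-one = suc-injective (begin
    suc (count y w)          ≡⟨ sym (count-∷-≡ y w) ⟩
    count y (y ∷ w)          ≡⟨ e ⟩
    2 + count x (y ∷ w)      ≡⟨ cong (2 +_) (count-∷-≢ w (x≢flip-x x)) ⟩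
    2 + count x w            ∎)
  -- Having just stepped from level 0 up to 1, the next step either goes up again or returns to 0.
  from-level-one : ∀ w → count y w ≡ 1 + count x w →
    ∃₂ λ p r → y ∷ w ≡ p ++ y ∷ y ∷ r × count y p ≡ count x p
  from-level-one [] ()
  from-level-one (d ∷ w) e′ with letter-view x d
  ... | inj₂ refl = [] , w , refl , refl
  ... | inj₁ refl =
    let p , r , w≡ , excess = yy-split x zero w back-to-zero in
    y ∷ x ∷ p , r , cong (λ t → y ∷ x ∷ t) w≡ , (begin
      count y (y ∷ x ∷ p)    ≡⟨ count-∷-≡ y (x ∷ p) ⟩
      suc (count y (x ∷ p))  ≡⟨ cong suc (count-∷-≢ p (flip-x≢x x)) ⟩
      suc (count y p)        ≡⟨ cong suc excess ⟩
      suc (count x p)        ≡⟨ sym (count-∷-≡ x p) ⟩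
      count x (x ∷ p)        ≡⟨ sym (count-∷-≢ (x ∷ p) (x≢flip-x x)) ⟩
      count x (y ∷ x ∷ p)    ∎)
    where
    back-to-zero : count y w ≡ 2 + count x w
    back-to-zero = begin
      count y w            ≡⟨ sym (count-∷-≢ w (flip-x≢x x)) ⟩
      count y (x ∷ w)      ≡⟨ e′ ⟩
      1 + count x (x ∷ w)  ≡⟨ cong suc (count-∷-≡ x w) ⟩
      2 + count x w        ∎

XYSplit : Str → Set
XYSplit s = ∃₂ λ t₁ t₂ → s ≡ t₁ ++ t₂ × XYBalanced t₁ × XYBalanced t₂
  × length t₁ > 0 × length t₂ > 0

XYSplit-xx : ∀ x q → Balanced (x ∷ q ∷ʳ x) → XYSplit (x ∷ q ∷ʳ x)
XYSplit-xx x q bal with yy-split x zero q (Balanced-xx⇒count-flip x q bal)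
... | p , r , refl , excess =
  t₁ , t₂ , s≡ , XYBalanced-wrap p (x≢flip-x x) bal₁
  , XYBalanced-wrap r (flip-x≢x x) (Balanced-++⁻ʳ t₁ t₂ (subst Balanced s≡ bal) bal₁)
  , s≤s z≤n , s≤s z≤n
  where
  y : AB
  y = flip x
  t₁ t₂ : Str
  t₁ = x ∷ p ∷ʳ y
  t₂ = y ∷ r ∷ʳ x
  s≡ : x ∷ (p ++ y ∷ y ∷ r) ∷ʳ x ≡ t₁ ++ t₂
  s≡ = cong (x ∷_) (trans (++-assoc p (y ∷ y ∷ r) [ x ]) (sym (++-assoc p [ y ] (y ∷ r ∷ʳ x))))
  bal₁ : Balanced t₁
  bal₁ = Balanced-wrap x p (count-flip≡count⇒Balanced x p excess)

lemma2 : (s : Str) → XXBalanced s → length s > 0 →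
    ∃₂ λ t₁ t₂ → s ≡ t₁ ++ t₂ × XYBalanced t₁ × XYBalanced t₂
      × length t₁ > 0 × length t₂ > 0
lemma2 s xx len with initLast s
lemma2 .[] _ () | []
lemma2 .([] ∷ʳ z) (bal , _) _ | [] ∷ʳ′ z with () ← Balanced-[ z ]-impossible bal
lemma2 .((x ∷ q) ∷ʳ z) (bal , inj₁ ()) _ | (x ∷ q) ∷ʳ′ z
lemma2 .((x ∷ q) ∷ʳ z) (bal , inj₂ ends) _ | (x ∷ q) ∷ʳ′ z
  with refl ← ends x z (first x _) (Last-∷ʳ (x ∷ q) z) = XYSplit-xx x q bal
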